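{- Let $G$ be a finite directed graph, $k\ge1$ an integer, and $r\in V(G)$ with positive in-degree and positive out-degree. In algorithm APAD (described in the context), each per-iteration estimate $\mathbf{c}_\tau$ satisfies \[ \mathrm{Var}[\mathbf{c}_\tau]\le\alpha'(r)\,pc(r),\qquad\text{where } \alpha'(r)=\frac{|\mathcal{RF}(r)|}{|V(G)|}. \]
   Context: $G$ is a finite, unweighted directed graph without self-loops or multiple edges, assumed (weakly) connected. $N(v)$ is the set of out-neighbours of $v$. For a vertex $s$ and integer $l\ge1$, $p_{s,l}$ denotes a simple directed path $s=u_0,u_1,\dots,u_l$ with $l$ edges starting at $s$; define $\mathcal{W}(p_{s,l})=\prod_{i=1}^{l}\frac{1}{|N(u_{i-1})\setminus\{s,u_1,\dots,u_{i-2}\}|}$ (for $i=1$ the removed set is $\{s\}$). $\chi[r\in p_{s,l}]$ is $1$ if $r$ is a vertex of $p_{s,l}$ and $0$ otherwise. The $k$-path centrality of $r$ is $pc(r)=\frac{1}{k|V(G)|}\sum_{s\in V(G)\setminus\{r\}}\sum_{1\le l\le k}\sum_{p_{s,l}}\chi[r\in p_{s,l}]\,\mathcal{W}(p_{s,l})$, the innermost sum over all simple paths with $l$ edges starting at $s$. $\mathcal{RF}(r)$ is the set of vertices $s\ne r$ with a directed path from $s$ to $r$; $\mathcal{RT}(r)$ is the set of vertices $t\ne r$ with a directed path from $r$ to $t$; $\mathcal{D}(r)=\mathcal{RF}(r)\cup\{r\}\cup\mathcal{RT}(r)$. Algorithm APAD: let $RF=\mathcal{RF}(r)$, $D=\mathcal{D}(r)$.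 In each iteration $\tau$: choose $s\in RF$ uniformly at random and $l\in\{1,\dots,k\}$ uniformly at random; build a path starting from $u_0=s$ where, for $i=1,\dots,l$, $u_i$ is chosen uniformly at random from $(N(u_{i-1})\cap D)\setminus\{s,u_1,\dots,u_{i-2}\}$; if this set is empty at some step, set $\mathbf{c}_\tau=0$. Otherwise the result is a path $p_{s,l}$ with $\mathbb{P}[p_{s,l}]=\prod_{i=1}^{l}\frac{1}{|(N(u_{i-1})\cap D)\setminus\{s,u_1,\dots,u_{i-2}\}|}$, and set $\mathbf{c}_\tau=\frac{|RF|\,\mathcal{W}(p_{s,l})}{|V(G)|\,\mathbb{P}[p_{s,l}]}$ if $r$ lies on $p_{s,l}$ and $\mathbf{c}_\tau=0$ otherwise. -}

module Defs where

open import Data.Bool using (Bool; true; false; _∧_; _∨_; not; if_then_else_)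
open import Data.Nat as ℕ using (ℕ; zero; suc)
open import Data.Integer using (+_)
open import Data.Fin using (Fin)
open import Data.Fin.Properties using () renaming (_≟_ to _≟ᶠ_)
open import Data.List using (List; []; _∷_; filter; map; concatMap; foldr; length; reverse; allFin)
open import Data.Bool.ListAction using (any)
open import Data.Sum using (_⊎_)
open import Relation.Binary.Construct.Closure.ReflexiveTransitive using (Star)
open import Data.Bool.Properties using () renaming (_≟_ to _≟ᵇ_)
open import Data.Maybe using (Maybe; just; nothing)
open import Data.Product using (_×_; _,_)
open import Data.Rational using (ℚ; 0ℚ; 1ℚ; _+_; _*_; _-_; _/_; _÷_; ≢-nonZero)
open import Data.Rational.Properties using () renaming (_≟_ to _≟ℚ_)
open import Relation.Nullary using (yes; no; does)
open import Relation.Binary.PropositionalEquality using (_≡_)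

ℕtoℚ : ℕ → ℚ
ℕtoℚ m = (+ m) / 1

-- division; the value at a zero denominator is irrelevant (only used
-- with nonzero denominators) and fixed to 0
_÷₀_ : ℚ → ℚ → ℚ
p ÷₀ q with q ≟ℚ 0ℚ
... | yes _ = 0ℚ
... | no q≢0 = _÷_ p q {{≢-nonZero q≢0}}

-- 1 / m for a natural m (0 ↦ 0, never used at 0)
inv : ℕ → ℚ
inv m = 1ℚ ÷₀ ℕtoℚ m

sumℚ : List ℚ → ℚ
sumℚ = foldr _+_ 0ℚ

Dist : Set → Set
Dist A = List (ℚ × A)

return : {A : Set} → A → Dist A
return a = (1ℚ , a) ∷ []

_>>=_ : {A B : Set} → Dist A → (A → Dist B) → Dist B
d >>= f = concatMap (λ { (p , a) → map (λ { (q , b) → (p * q , b) }) (f a) }) d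

uniform : {A : Set} → List A → Dist A
uniform xs = map (λ x → (inv (length xs) , x)) xs

mapD : {A B : Set} → (A → B) → Dist A → Dist B
mapD f = map (λ { (p , a) → (p , f a) })

𝔼 : Dist ℚ → ℚ
𝔼 d = sumℚ (map (λ { (p , x) → p * x }) d)

Var : Dist ℚ → ℚ
Var d = 𝔼 (mapD (λ x → x * x) d) - (𝔼 d * 𝔼 d)

module Graph {n : ℕ} (adj : Fin n → Fin n → Bool) where

  Edge : Fin n → Fin n → Set
  Edge u v = adj u v ≡ true

  Reach : Fin n → Fin n → Set
  Reach = Star Edge

  WeaklyConnected : Set
  WeaklyConnected = ∀ u v → Star (λ a b → Edge a b ⊎ Edge b a) u v

  card : (Fin n → Bool) → ℕ
  card P = length (filter (λ s → P s ≟ᵇ true) (allFin n))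

  _∈ᵇ_ : Fin n → List (Fin n) → Bool
  v ∈ᵇ xs = any (λ x → does (v ≟ᶠ x)) xs

  NminusP : (Fin n → Bool) → Fin n → List (Fin n) → List (Fin n)
  NminusP P v X = filter (λ w → adj v w ∧ P w ∧ not (w ∈ᵇ X) ≟ᵇ true) (allFin n)

  -- Paths are stored REVERSED: u_{i} ∷ u_{i-1} ∷ ... ∷ u_0 ∷ [].
  -- For a reversed partial path ending in u_{i-1}, 'removed' is the set
  -- {s, u_1, ..., u_{i-2}} of the paper (which is {s} when i = 1).
  removed : List (Fin n) → List (Fin n)
  removed (c ∷ []) = c ∷ []
  removed (c ∷ rest) = rest
  removed [] = []

  -- prod_{i=1}^{l} 1 / |(N(u_{i-1}) ∩ P) \ {s,u_1,...,u_{i-2}}|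
  -- for a reversed path; P = everything gives 𝒲, P = D gives ℙ.
  weight : (Fin n → Bool) → List (Fin n) → ℚ
  weight P [] = 1ℚ
  weight P (c ∷ []) = 1ℚ
  weight P (c ∷ u ∷ ps) = weight P (u ∷ ps) * inv (length (NminusP P u (removed (u ∷ ps))))

  allTrue : Fin n → Bool
  allTrue _ = true

  𝒲 : List (Fin n) → ℚ
  𝒲 = weight allTrue

  seqs : ℕ → List (List (Fin n))
  seqs zero = [] ∷ []
  seqs (suc m) = concatMap (λ v → map (v ∷_) (seqs m)) (allFin n)

  distinct : List (Fin n) → Bool
  distinct [] = true
  distinct (x ∷ xs) = not (x ∈ᵇ xs) ∧ distinct xs

  chain : List (Fin n) → Bool
  chain [] = true
  chain (x ∷ []) = true
  chain (x ∷ y ∷ xs) = adj x y ∧ chain (y ∷ xs)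

  startsAt : Fin n → List (Fin n) → Bool
  startsAt s [] = false
  startsAt s (x ∷ _) = does (s ≟ᶠ x)

  -- all simple directed paths s = u_0, ..., u_l with l edges (forward order)
  simplePaths : Fin n → ℕ → List (List (Fin n))
  simplePaths s l = filter (λ p → startsAt s p ∧ distinct p ∧ chain p ≟ᵇ true) (seqs (suc l))

  χ : Fin n → List (Fin n) → ℚ
  χ r p = if r ∈ᵇ p then 1ℚ else 0ℚ

  pc : ℕ → Fin n → ℚ
  pc k r = inv (k ℕ.* n) *
    sumℚ (map (λ s → if does (s ≟ᶠ r) then 0ℚ else
      sumℚ (map (λ l → sumℚ (map (λ p → χ r p * 𝒲 (reverse p)) (simplePaths s l)))
                (Data.List.map suc (Data.List.upTo k))))
      (allFin n))
    where import Data.List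

  -- random walk: 'm' steps remaining, reversed partial path 'ps';
  -- outcome: nothing = some candidate set was empty, just p = reversed path
  walk : (Fin n → Bool) → ℕ → List (Fin n) → Dist (Maybe (List (Fin n)))
  walk D zero ps = return (just ps)
  walk D (suc m) [] = return nothing
  walk D (suc m) (c ∷ ps) with NminusP D c (removed (c ∷ ps))
  ... | [] = return nothing
  ... | cand@(_ ∷ _) = uniform cand >>= λ v → walk D m (v ∷ c ∷ ps)

  estimate : (RF D : Fin n → Bool) → Fin n → Maybe (List (Fin n)) → ℚ
  estimate RF D r nothing = 0ℚ
  estimate RF D r (just p) =
    if r ∈ᵇ p
    then (ℕtoℚ (card RF) * 𝒲 p)
           ÷₀ (ℕtoℚ n * weight D p)
    else 0ℚ

  APAD-c : (k : ℕ) (RF D : Fin n → Bool) (r : Fin n) → Dist ℚ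
  APAD-c k RF D r =
    uniform (filter (λ s → RF s ≟ᵇ true) (allFin n)) >>= λ s →
    uniform (Data.List.map suc (Data.List.upTo k)) >>= λ l →
    mapD (estimate RF D r) (walk D l (s ∷ []))
    where
      import Data.List

{-# OPTIONS --safe #-}
-- Since Var c ≤ 𝔼[c²], it suffices to bound the second moment. When the walk
-- started at s produces the path p, it does so with probability ℙ(p), and
-- c = α 𝒲(p) / ℙ(p) if r ∈ p (α = |RF|/|V|), so ℙ(p) c² = α² 𝒲(p) · 𝒲(p)/ℙ(p).
-- The walk chooses among the out-neighbours inside D, a subset of all
-- out-neighbours, so 𝒲(p) ≤ ℙ(p) and ℙ(p) c² ≤ α² χ[r ∈ p] 𝒲(p). Every path the
-- walk produces is a simple path from s, so summing over its outcomes (by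
-- induction on the remaining steps) gives at most α² Σ_p χ[r ∈ p] 𝒲(p) over all
-- simple paths from s. Averaging over s ∈ RF (where s ≠ r) and l ≤ k yields
-- 𝔼[c²] ≤ α² /(|RF| k) · Σ_{s ≠ r} Σ_l Σ_p χ 𝒲 = α · pc(r).
module Submission where

module Arithmetic where

  open import Data.Nat as ℕ using (ℕ; zero; suc)
  import Data.Nat.Properties as ℕₚ
  import Data.Nat.Coprimality as Coprimality
  import Data.Integer as ℤ
  import Data.Integer.Properties as ℤ
  open import Data.Rational
  open import Data.Rational.Properties
  import Data.Rational.Unnormalised as ℚᵘ
  import Data.Rational.Unnormalised.Properties as ℚᵘ
  open import Data.Rational.Solver using (module +-*-Solver)
  open import Relation.Binary.PropositionalEquality
  open import Relation.Nullary using (yes; no; contradiction)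
  open import Data.Sum using (inj₁; inj₂)
  open import Defs using (ℕtoℚ; _÷₀_; inv)

  *-nonNeg : ∀ {p q} → 0ℚ ≤ p → 0ℚ ≤ q → 0ℚ ≤ p * q
  *-nonNeg {p} {q} p≥0 q≥0 = nonNegative⁻¹ (p * q) {{nonNeg*nonNeg⇒nonNeg p {{nonNegative p≥0}} q {{nonNegative q≥0}}}}

  square-nonNeg : ∀ p → 0ℚ ≤ p * p
  square-nonNeg p with ≤-total 0ℚ p
  ... | inj₁ p≥0 = *-nonNeg p≥0 p≥0
  ... | inj₂ p≤0 = nonNegative⁻¹ _ {{nonPos*nonPos⇒nonPos p {{nonPositive p≤0}} p {{nonPositive p≤0}}}}

  1/⁺_ : (q : ℚ) .{{_ : Positive q}} → ℚ
  1/⁺ q = (1/ q) {{pos⇒nonZero q}}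

  *-1/⁺ : ∀ q .{{_ : Positive q}} → q * 1/⁺ q ≡ 1ℚ
  *-1/⁺ q = *-inverseʳ q {{pos⇒nonZero q}}

  1/⁺-positive : ∀ q .{{_ : Positive q}} → Positive (1/⁺ q)
  1/⁺-positive q = 1/pos⇒pos q

  1/⁺-* : ∀ p q .{{_ : Positive p}} .{{_ : Positive q}} →
    1/⁺_ (p * q) {{pos*pos⇒pos p q}} ≡ 1/⁺ p * 1/⁺ q
  1/⁺-* p q = begin
    x                      ≡⟨ *-identityʳ x ⟨
    x * 1ℚ                 ≡⟨ cong (x *_) (begin
       1ℚ                  ≡⟨ cong₂ _*_ (*-1/⁺ p) (*-1/⁺ q) ⟨
       (p * 1/⁺ p) * (q * 1/⁺ q)  ≡⟨ solve 4 (λ p p' q q' → (p :* p') :* (q :* q') := (p :* q) :* (p' :* q')) refl p (1/⁺ p) q (1/⁺ q) ⟩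
       (p * q) * y         ∎) ⟩
    x * ((p * q) * y)      ≡⟨ *-assoc x (p * q) y ⟨
    (x * (p * q)) * y      ≡⟨ cong (_* y) (trans (*-comm x (p * q)) (*-1/⁺ (p * q) {{pos*pos⇒pos p q}})) ⟩
    1ℚ * y                 ≡⟨ *-identityˡ y ⟩
    y                      ∎
    where
    open ≡-Reasoning
    open +-*-Solver
    x = 1/⁺_ (p * q) {{pos*pos⇒pos p q}}
    y = 1/⁺ p * 1/⁺ q

  1/⁺-antimono-≤ : ∀ p q .{{_ : Positive p}} .{{_ : Positive q}} → p ≤ q → 1/⁺ q ≤ 1/⁺ p
  1/⁺-antimono-≤ p q p≤q = begin
    1/⁺ q                    ≡⟨ *-identityʳ (1/⁺ q) ⟨
    1/⁺ q * 1ℚ               ≡⟨ cong (1/⁺ q *_) (*-1/⁺ p) ⟨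
    1/⁺ q * (p * 1/⁺ p)      ≤⟨ *-monoˡ-≤-nonNeg (1/⁺ q) {{pos⇒nonNeg (1/⁺ q) {{1/⁺-positive q}}}}
                                 (*-monoʳ-≤-nonNeg (1/⁺ p) {{pos⇒nonNeg (1/⁺ p) {{1/⁺-positive p}}}} p≤q) ⟩
    1/⁺ q * (q * 1/⁺ p)      ≡⟨ *-assoc (1/⁺ q) q (1/⁺ p) ⟨
    (1/⁺ q * q) * 1/⁺ p      ≡⟨ cong (_* 1/⁺ p) (trans (*-comm (1/⁺ q) q) (*-1/⁺ q)) ⟩
    1ℚ * 1/⁺ p               ≡⟨ *-identityˡ (1/⁺ p) ⟩
    1/⁺ p                    ∎
    where open ≤-Reasoning

  ÷₀-≡-*-1/⁺ : ∀ p q .{{_ : Positive q}} → p ÷₀ q ≡ p * 1/⁺ q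
  ÷₀-≡-*-1/⁺ p q = helper (λ q≡0 → <-irrefl (sym q≡0) (positive⁻¹ q))
    where
    helper : (q≢0 : q ≢ 0ℚ) → p ÷₀ q ≡ p * (1/ q) {{≢-nonZero q≢0}}
    helper q≢0 with q ≟ 0ℚ
    ... | yes q≡0 = contradiction q≡0 q≢0
    ... | no _ = refl

  ℕ→mkℚ : ℕ → ℚ
  ℕ→mkℚ m = mkℚ (ℤ.+ m) 0 (Coprimality.sym (Coprimality.1-coprimeTo m))

  -- ℕtoℚ m = (+ m) / 1 only reduces through a gcd computation that is stuck on a
  -- variable m; the order and the arithmetic of ℚ compute on this normal form.
  ℕtoℚ-mkℚ : ∀ m → ℕtoℚ m ≡ ℕ→mkℚ m
  ℕtoℚ-mkℚ m = normalize-coprime _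

  ℕtoℚ-suc-positive : ∀ m → Positive (ℕtoℚ (suc m))
  ℕtoℚ-suc-positive m = subst Positive (sym (ℕtoℚ-mkℚ (suc m))) _

  ℕtoℚ-mono-≤ : ∀ {a b} → a ℕ.≤ b → ℕtoℚ a ≤ ℕtoℚ b
  ℕtoℚ-mono-≤ {a} {b} a≤b rewrite ℕtoℚ-mkℚ a | ℕtoℚ-mkℚ b =
    *≤* (subst₂ ℤ._≤_ (sym (ℤ.*-identityʳ _)) (sym (ℤ.*-identityʳ _)) (ℤ.+≤+ a≤b))

  ℕtoℚ-* : ∀ a b → ℕtoℚ (a ℕ.* b) ≡ ℕtoℚ a * ℕtoℚ b
  ℕtoℚ-* a b rewrite ℕtoℚ-mkℚ a | ℕtoℚ-mkℚ b | ℕtoℚ-mkℚ (a ℕ.* b) =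
    toℚᵘ-injective (ℚᵘ.≃-trans (ℚᵘ.*≡* (cong (ℤ._* ℤ.+ 1) (ℤ.pos-* a b)))
                               (ℚᵘ.≃-sym (toℚᵘ-homo-* (ℕ→mkℚ a) (ℕ→mkℚ b))))

  1/⁺-cong : ∀ {p q} .{{_ : Positive p}} .{{_ : Positive q}} → p ≡ q → 1/⁺ p ≡ 1/⁺ q
  1/⁺-cong refl = refl

  inv-suc : ∀ m → inv (suc m) ≡ 1/⁺_ (ℕtoℚ (suc m)) {{ℕtoℚ-suc-positive m}}
  inv-suc m = trans (÷₀-≡-*-1/⁺ 1ℚ (ℕtoℚ (suc m)) {{ℕtoℚ-suc-positive m}}) (*-identityˡ _)

  inv-suc-positive : ∀ m → Positive (inv (suc m))
  inv-suc-positive m =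
    subst Positive (sym (inv-suc m)) (1/⁺-positive (ℕtoℚ (suc m)) {{ℕtoℚ-suc-positive m}})

  inv-nonNeg : ∀ m → 0ℚ ≤ inv m
  inv-nonNeg zero = ≤-refl
  inv-nonNeg (suc m) = <⇒≤ (positive⁻¹ (inv (suc m)) {{inv-suc-positive m}})

  inv-antimono-≤ : ∀ {a b} → suc a ℕ.≤ b → inv b ≤ inv (suc a)
  inv-antimono-≤ {a} {suc b} a<b rewrite inv-suc a | inv-suc b =
    1/⁺-antimono-≤ (ℕtoℚ (suc a)) (ℕtoℚ (suc b)) {{ℕtoℚ-suc-positive a}} {{ℕtoℚ-suc-positive b}}
      (ℕtoℚ-mono-≤ a<b)

  inv-* : ∀ a b → inv (a ℕ.* b) ≡ inv a * inv b
  inv-* zero b = sym (*-zeroˡ (inv b))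
  inv-* (suc a) zero rewrite ℕₚ.*-zeroʳ a = sym (*-zeroʳ (inv (suc a)))
  inv-* (suc a) (suc b) = begin
    inv (suc a ℕ.* suc b)          ≡⟨ inv-suc (b ℕ.+ a ℕ.* suc b) ⟩
    1/⁺_ (ℕtoℚ (suc a ℕ.* suc b)) {{ℕtoℚ-suc-positive (b ℕ.+ a ℕ.* suc b)}}
                                   ≡⟨ 1/⁺-cong {{ℕtoℚ-suc-positive (b ℕ.+ a ℕ.* suc b)}} {{AB⁺}} (ℕtoℚ-* (suc a) (suc b)) ⟩
    1/⁺_ (A * B) {{AB⁺}}           ≡⟨ 1/⁺-* A B {{A⁺}} {{B⁺}} ⟩
    1/⁺_ A {{A⁺}} * 1/⁺_ B {{B⁺}}  ≡⟨ cong₂ _*_ (inv-suc a) (inv-suc b) ⟨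
    inv (suc a) * inv (suc b)      ∎
    where
    open ≡-Reasoning
    A = ℕtoℚ (suc a)
    B = ℕtoℚ (suc b)
    A⁺ = ℕtoℚ-suc-positive a
    B⁺ = ℕtoℚ-suc-positive b
    AB⁺ = pos*pos⇒pos A {{A⁺}} B {{B⁺}}

  ÷₀-*-interchange : ∀ a b c d .{{_ : Positive c}} .{{_ : Positive d}} →
    (a * b) ÷₀ (c * d) ≡ (a ÷₀ c) * (b ÷₀ d)
  ÷₀-*-interchange a b c d = begin
    (a * b) ÷₀ (c * d)                 ≡⟨ ÷₀-≡-*-1/⁺ (a * b) (c * d) {{pos*pos⇒pos c d}} ⟩
    (a * b) * 1/⁺_ (c * d) {{pos*pos⇒pos c d}} ≡⟨ cong ((a * b) *_) (1/⁺-* c d) ⟩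
    (a * b) * (1/⁺ c * 1/⁺ d)          ≡⟨ solve 4 (λ a b c d → (a :* b) :* (c :* d) := (a :* c) :* (b :* d)) refl a b (1/⁺ c) (1/⁺ d) ⟩
    (a * 1/⁺ c) * (b * 1/⁺ d)          ≡⟨ cong₂ _*_ (÷₀-≡-*-1/⁺ a c) (÷₀-≡-*-1/⁺ b d) ⟨
    (a ÷₀ c) * (b ÷₀ d)                ∎
    where
    open ≡-Reasoning
    open +-*-Solver

  *-÷₀-cancel : ∀ p q .{{_ : Positive q}} → q * (p ÷₀ q) ≡ p
  *-÷₀-cancel p q = begin
    q * (p ÷₀ q)    ≡⟨ cong (q *_) (÷₀-≡-*-1/⁺ p q) ⟩
    q * (p * 1/⁺ q) ≡⟨ solve 3 (λ q p u → q :* (p :* u) := p :* (q :* u)) refl q p (1/⁺ q) ⟩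
    p * (q * 1/⁺ q) ≡⟨ cong (p *_) (*-1/⁺ q) ⟩
    p * 1ℚ          ≡⟨ *-identityʳ p ⟩
    p               ∎
    where
    open ≡-Reasoning
    open +-*-Solver

  ÷₀-≤-1 : ∀ {p q} .{{_ : Positive q}} → p ≤ q → p ÷₀ q ≤ 1ℚ
  ÷₀-≤-1 {p} {q} p≤q = begin
    p ÷₀ q    ≡⟨ ÷₀-≡-*-1/⁺ p q ⟩
    p * 1/⁺ q ≤⟨ *-monoʳ-≤-nonNeg (1/⁺ q) {{pos⇒nonNeg (1/⁺ q) {{1/⁺-positive q}}}} p≤q ⟩
    q * 1/⁺ q ≡⟨ *-1/⁺ q ⟩
    1ℚ        ∎
    where open ≤-Reasoning

  *-square-÷₀-≤ : ∀ a w p .{{_ : Positive p}} → 0ℚ ≤ w → w ≤ p →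
    p * ((a * (w ÷₀ p)) * (a * (w ÷₀ p))) ≤ (a * a) * w
  *-square-÷₀-≤ a w p w≥0 w≤p = begin
    p * ((a * x) * (a * x)) ≡⟨ solve 3 (λ p a x → p :* ((a :* x) :* (a :* x)) := (a :* a) :* ((p :* x) :* x)) refl p a x ⟩
    (a * a) * ((p * x) * x) ≡⟨ cong (λ y → (a * a) * (y * x)) (*-÷₀-cancel w p) ⟩
    (a * a) * (w * x)       ≤⟨ *-monoˡ-≤-nonNeg (a * a) {{nonNegative (square-nonNeg a)}}
                                 (*-monoˡ-≤-nonNeg w {{nonNegative w≥0}} (÷₀-≤-1 w≤p)) ⟩
    (a * a) * (w * 1ℚ)      ≡⟨ cong ((a * a) *_) (*-identityʳ w) ⟩
    (a * a) * w             ∎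
    where
    open ≤-Reasoning
    open +-*-Solver
    x = w ÷₀ p

  inv-*-÷₀-square : ∀ c q .{{_ : Positive q}} →
    inv c * ((ℕtoℚ c ÷₀ q) * (ℕtoℚ c ÷₀ q)) ≡ (ℕtoℚ c ÷₀ q) * (1ℚ ÷₀ q)
  inv-*-÷₀-square zero q = begin
    inv 0 * (α * α)      ≡⟨ *-zeroˡ (α * α) ⟩
    0ℚ                   ≡⟨ *-zeroˡ (1ℚ ÷₀ q) ⟨
    0ℚ * (1ℚ ÷₀ q)       ≡⟨ cong (_* (1ℚ ÷₀ q)) (trans (÷₀-≡-*-1/⁺ 0ℚ q) (*-zeroˡ (1/⁺ q))) ⟨
    α * (1ℚ ÷₀ q)        ∎
    where
    open ≡-Reasoning
    α = ℕtoℚ 0 ÷₀ q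
  inv-*-÷₀-square (suc c) q = begin
    inv (suc c) * ((C ÷₀ q) * (C ÷₀ q))
      ≡⟨ cong₂ (λ i α → i * (α * α)) (inv-suc c) (÷₀-≡-*-1/⁺ C q) ⟩
    1/⁺ C * ((C * u) * (C * u))
      ≡⟨ solve 3 (λ i C u → i :* ((C :* u) :* (C :* u)) := ((C :* u) :* u) :* (C :* i)) refl (1/⁺ C) C u ⟩
    ((C * u) * u) * (C * 1/⁺ C) ≡⟨ cong (((C * u) * u) *_) (*-1/⁺ C) ⟩
    ((C * u) * u) * 1ℚ          ≡⟨ *-identityʳ _ ⟩
    (C * u) * u                 ≡⟨ cong₂ _*_ (÷₀-≡-*-1/⁺ C q) (trans (÷₀-≡-*-1/⁺ 1ℚ q) (*-identityˡ u)) ⟨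
    (C ÷₀ q) * (1ℚ ÷₀ q)        ∎
    where
    open ≡-Reasoning
    open +-*-Solver
    C = ℕtoℚ (suc c)
    instance C⁺ : Positive C
    C⁺ = ℕtoℚ-suc-positive c
    u = 1/⁺ q

module Expectation where

  open import Data.List using (List; []; _∷_; _++_; map; concatMap; filter; length)
  open import Data.List.Membership.Propositional using (_∈_)
  open import Data.List.Relation.Unary.Any using (here; there)
  open import Data.Bool using (if_then_else_)
  open import Data.Product using (_,_)
  open import Data.Rational using (ℚ; 0ℚ; _+_; _*_; _≤_)
  open import Data.Rational.Properties
  open import Level using (0ℓ)
  open import Relation.Binary.PropositionalEquality
  open import Relation.Nullary using (yes; no; does)
  open import Relation.Unary using (Pred; Decidable)
  open import Defs using (sumℚ; Dist; _>>=_; uniform; mapD; 𝔼; inv)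

  ∑ : {A : Set} → List A → (A → ℚ) → ℚ
  ∑ xs f = sumℚ (map f xs)

  syntax ∑ xs (λ x → e) = ∑[ x ← xs ] e

  private variable A B : Set

  ∑-cong : ∀ xs {f g : A → ℚ} → (∀ x → f x ≡ g x) → ∑ xs f ≡ ∑ xs g
  ∑-cong [] f≗g = refl
  ∑-cong (x ∷ xs) f≗g = cong₂ _+_ (f≗g x) (∑-cong xs f≗g)

  ∑-mono-≤ : ∀ xs {f g : A → ℚ} → (∀ x → f x ≤ g x) → ∑ xs f ≤ ∑ xs g
  ∑-mono-≤ [] f≤g = ≤-refl
  ∑-mono-≤ (x ∷ xs) f≤g = +-mono-≤ (f≤g x) (∑-mono-≤ xs f≤g)

  ∑-nonNeg : ∀ xs {f : A → ℚ} → (∀ x → 0ℚ ≤ f x) → 0ℚ ≤ ∑ xs f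
  ∑-nonNeg [] f≥0 = ≤-refl
  ∑-nonNeg (x ∷ xs) f≥0 = +-mono-≤ (f≥0 x) (∑-nonNeg xs f≥0)

  *-distribˡ-∑ : ∀ c xs (f : A → ℚ) → c * ∑ xs f ≡ ∑[ x ← xs ] (c * f x)
  *-distribˡ-∑ c [] f = *-zeroʳ c
  *-distribˡ-∑ c (x ∷ xs) f = trans (*-distribˡ-+ c (f x) _) (cong (c * f x +_) (*-distribˡ-∑ c xs f))

  ∑-++ : ∀ xs ys (f : A → ℚ) → ∑ (xs ++ ys) f ≡ ∑ xs f + ∑ ys f
  ∑-++ [] ys f = sym (+-identityˡ _)
  ∑-++ (x ∷ xs) ys f = trans (cong (f x +_) (∑-++ xs ys f)) (sym (+-assoc (f x) _ _))

  ∑-map : (xs : List A) (g : A → B) (f : B → ℚ) → ∑ (map g xs) f ≡ ∑[ x ← xs ] f (g x)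
  ∑-map [] g f = refl
  ∑-map (x ∷ xs) g f = cong (f (g x) +_) (∑-map xs g f)

  ∑-concatMap : (xs : List A) (g : A → List B) (f : B → ℚ) →
    ∑ (concatMap g xs) f ≡ ∑[ x ← xs ] ∑ (g x) f
  ∑-concatMap [] g f = refl
  ∑-concatMap (x ∷ xs) g f = trans (∑-++ (g x) (concatMap g xs) f) (cong (∑ (g x) f +_) (∑-concatMap xs g f))

  ∈⇒≤∑ : ∀ {xs x} (f : A → ℚ) → (∀ y → 0ℚ ≤ f y) → x ∈ xs → f x ≤ ∑ xs f
  ∈⇒≤∑ {xs = y ∷ ys} f f≥0 (here refl) = subst (_≤ f y + ∑ ys f) (+-identityʳ (f y)) (+-monoʳ-≤ (f y) (∑-nonNeg ys f≥0))
  ∈⇒≤∑ {xs = y ∷ ys} {x} f f≥0 (there x∈ys) = subst (_≤ f y + ∑ ys f) (+-identityˡ (f x)) (+-mono-≤ (f≥0 y) (∈⇒≤∑ f f≥0 x∈ys))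

  ∑-filter-≤ : {P : Pred A 0ℓ} (P? : Decidable P) (xs : List A) {f g : A → ℚ} →
    (∀ x → P x → f x ≤ g x) → (∀ x → 0ℚ ≤ g x) → ∑ (filter P? xs) f ≤ ∑ xs g
  ∑-filter-≤ P? [] f≤g g≥0 = ≤-refl
  ∑-filter-≤ P? (x ∷ xs) {f} {g} f≤g g≥0 with P? x
  ... | yes px = +-mono-≤ (f≤g x px) (∑-filter-≤ P? xs f≤g g≥0)
  ... | no _ = subst (_≤ g x + ∑ xs g) (+-identityˡ _) (+-mono-≤ (g≥0 x) (∑-filter-≤ P? xs f≤g g≥0))

  ∑-filter : {P : Pred A 0ℓ} (P? : Decidable P) (xs : List A) (f : A → ℚ) →
    ∑ (filter P? xs) f ≡ ∑[ x ← xs ] (if does (P? x) then f x else 0ℚ)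
  ∑-filter P? [] f = refl
  ∑-filter P? (x ∷ xs) f with P? x
  ... | yes _ = cong (f x +_) (∑-filter P? xs f)
  ... | no _ = trans (∑-filter P? xs f) (sym (+-identityˡ _))

  𝔼[_∣_] : (A → ℚ) → Dist A → ℚ
  𝔼[ f ∣ d ] = ∑[ (p , a) ← d ] (p * f a)

  𝔼-𝔼[id] : (d : Dist ℚ) → 𝔼 d ≡ 𝔼[ (λ x → x) ∣ d ]
  𝔼-𝔼[id] d = ∑-cong d (λ { (p , x) → refl })

  𝔼[∣mapD] : (f : A → ℚ) (g : ℚ → ℚ) (d : Dist A) → 𝔼[ g ∣ mapD f d ] ≡ 𝔼[ (λ a → g (f a)) ∣ d ]
  𝔼[∣mapD] f g d = trans (∑-map d _ _) (∑-cong d (λ { (p , a) → refl }))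

  𝔼[∣>>=] : (f : B → ℚ) (d : Dist A) (k : A → Dist B) →
    𝔼[ f ∣ d >>= k ] ≡ 𝔼[ (λ a → 𝔼[ f ∣ k a ]) ∣ d ]
  𝔼[∣>>=] f [] k = refl
  𝔼[∣>>=] f ((p , a) ∷ d) k = begin
    𝔼[ f ∣ map _ (k a) ++ (d >>= k) ]       ≡⟨ ∑-++ (map _ (k a)) (d >>= k) _ ⟩
    𝔼[ f ∣ map _ (k a) ] + 𝔼[ f ∣ d >>= k ] ≡⟨ cong₂ _+_ scaled (𝔼[∣>>=] f d k) ⟩
    p * 𝔼[ f ∣ k a ] + 𝔼[ (λ a → 𝔼[ f ∣ k a ]) ∣ d ] ∎
    where
    open ≡-Reasoning
    scaled : 𝔼[ f ∣ map _ (k a) ] ≡ p * 𝔼[ f ∣ k a ]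
    scaled = trans (∑-map (k a) _ _) (trans (∑-cong (k a) (λ { (q , b) → *-assoc p q (f b) })) (sym (*-distribˡ-∑ p (k a) _)))

  𝔼[∣uniform] : (f : A → ℚ) (xs : List A) → 𝔼[ f ∣ uniform xs ] ≡ ∑[ x ← xs ] (inv (length xs) * f x)
  𝔼[∣uniform] f xs = ∑-map xs _ _

module Walks where

  open import Data.Nat as ℕ using (ℕ; zero; suc)
  open import Data.Fin using (Fin)
  open import Data.Fin.Properties using () renaming (_≟_ to _≟ᶠ_)
  open import Data.Bool using (Bool; true; false; _∧_; _∨_; not; if_then_else_)
  open import Data.Bool.Properties using (∨-assoc; ∨-comm; ∨-identityʳ) renaming (_≟_ to _≟ᵇ_)
  open import Data.List using (List; []; _∷_; _++_; _∷ʳ_; map; filter; length; reverse; allFin)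
  import Data.List.Properties as List
  open import Data.List.Membership.Propositional.Properties using (∈-allFin)
  open import Data.List.Relation.Binary.Sublist.Propositional using (⊆-refl)
  open import Data.List.Relation.Binary.Sublist.Propositional.Properties using (filter⁺; length-mono-≤)
  open import Data.Maybe using (Maybe; just; nothing)
  open import Data.Product using (_×_; _,_; proj₁; proj₂)
  open import Data.Rational using (ℚ; 0ℚ; 1ℚ; _+_; _*_; _≤_; _<_; *≤*; *<*; nonNegative; positive)
  open import Data.Integer using (+≤+; +<+)
  open import Data.Rational.Properties
  open import Level using (0ℓ)
  open import Relation.Unary using (Pred; Decidable)
  open import Relation.Binary.PropositionalEquality
  open import Relation.Nullary using (does; contradiction)
  open import Relation.Nullary.Decidable using (dec-true; dec-false)
  open import Defs
  open Arithmetic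
  open Expectation

  ∧-≡-true : ∀ {a b} → a ∧ b ≡ true → a ≡ true × b ≡ true
  ∧-≡-true {true} {true} _ = refl , refl

  ∨-≡-false : ∀ {a b} → a ∨ b ≡ false → a ≡ false × b ≡ false
  ∨-≡-false {false} {false} _ = refl , refl

  not-≡-true : ∀ {b} → not b ≡ true → b ≡ false
  not-≡-true {false} _ = refl

  length-filter-mono : {A : Set} {P Q : Pred A 0ℓ} (P? : Decidable P) (Q? : Decidable Q) →
    (∀ {x} → P x → Q x) → (xs : List A) → length (filter P? xs) ℕ.≤ length (filter Q? xs)
  length-filter-mono P? Q? P⇒Q xs = length-mono-≤ (filter⁺ P? Q? {xs} {xs} (λ { refl → P⇒Q }) ⊆-refl)

  does-≟-true : ∀ b → does (b ≟ᵇ true) ≡ b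
  does-≟-true true = refl
  does-≟-true false = refl

  module _ {n : ℕ} (adj : Fin n → Fin n → Bool) where
    open Graph adj

    ∈ᵇ-++ : ∀ v xs ys → v ∈ᵇ (xs ++ ys) ≡ (v ∈ᵇ xs) ∨ (v ∈ᵇ ys)
    ∈ᵇ-++ v [] ys = refl
    ∈ᵇ-++ v (x ∷ xs) ys = trans (cong (does (v ≟ᶠ x) ∨_) (∈ᵇ-++ v xs ys)) (sym (∨-assoc (does (v ≟ᶠ x)) _ _))

    ∈ᵇ-reverse : ∀ v xs → v ∈ᵇ reverse xs ≡ v ∈ᵇ xs
    ∈ᵇ-reverse v [] = refl
    ∈ᵇ-reverse v (x ∷ xs) = begin
      v ∈ᵇ reverse (x ∷ xs)                       ≡⟨ cong (v ∈ᵇ_) (List.unfold-reverse x xs) ⟩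
      v ∈ᵇ (reverse xs ∷ʳ x)                      ≡⟨ ∈ᵇ-++ v (reverse xs) (x ∷ []) ⟩
      (v ∈ᵇ reverse xs) ∨ (does (v ≟ᶠ x) ∨ false) ≡⟨ cong₂ _∨_ (∈ᵇ-reverse v xs) (∨-identityʳ _) ⟩
      (v ∈ᵇ xs) ∨ does (v ≟ᶠ x)                   ≡⟨ ∨-comm (v ∈ᵇ xs) _ ⟩
      does (v ≟ᶠ x) ∨ (v ∈ᵇ xs)                   ∎
      where open ≡-Reasoning

    distinct-∷ʳ : ∀ xs v → distinct xs ≡ true → v ∈ᵇ xs ≡ false → distinct (xs ∷ʳ v) ≡ true
    distinct-∷ʳ [] v _ _ = refl
    distinct-∷ʳ (x ∷ xs) v x∷xs-distinct v∉x∷xs = cong₂ _∧_ x∉xs∷ʳv (distinct-∷ʳ xs v xs-distinct v∉xs)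
      where
      x∉xs = proj₁ (∧-≡-true {not (x ∈ᵇ xs)} x∷xs-distinct)
      xs-distinct = proj₂ (∧-≡-true {not (x ∈ᵇ xs)} x∷xs-distinct)
      v≢x = proj₁ (∨-≡-false {does (v ≟ᶠ x)} v∉x∷xs)
      v∉xs = proj₂ (∨-≡-false {does (v ≟ᶠ x)} v∉x∷xs)
      x≢v : does (x ≟ᶠ v) ≡ false
      x≢v = dec-false (x ≟ᶠ v) λ { refl → contradiction (trans (sym (dec-true (v ≟ᶠ v) refl)) v≢x) λ () }
      x∉xs∷ʳv : not (x ∈ᵇ (xs ∷ʳ v)) ≡ true
      x∉xs∷ʳv rewrite ∈ᵇ-++ x xs (v ∷ []) | x≢v | ∨-identityʳ (x ∈ᵇ xs) = x∉xs

    chain-∷ʳ : ∀ ys c v → chain (ys ∷ʳ c) ≡ true → adj c v ≡ true → chain (ys ∷ʳ c ∷ʳ v) ≡ true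
    chain-∷ʳ [] c v _ cv = cong (_∧ true) cv
    chain-∷ʳ (y ∷ []) c v yc cv = cong₂ _∧_ (proj₁ (∧-≡-true {adj y c} yc)) (cong (_∧ true) cv)
    chain-∷ʳ (y ∷ z ∷ zs) c v chained cv =
      cong₂ _∧_ (proj₁ (∧-≡-true {adj y z} chained)) (chain-∷ʳ (z ∷ zs) c v (proj₂ (∧-≡-true {adj y z} chained)) cv)

    weight-nonNeg : ∀ P ps → 0ℚ ≤ weight P ps
    weight-nonNeg P [] = *≤* (+≤+ ℕ.z≤n)
    weight-nonNeg P (c ∷ []) = *≤* (+≤+ ℕ.z≤n)
    weight-nonNeg P (c ∷ u ∷ ps) =
      *-nonNeg (weight-nonNeg P (u ∷ ps)) (inv-nonNeg (length (NminusP P u (removed (u ∷ ps)))))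

    χ-nonNeg : ∀ r p → 0ℚ ≤ χ r p
    χ-nonNeg r p with r ∈ᵇ p
    ... | true = *≤* (+≤+ ℕ.z≤n)
    ... | false = ≤-refl

    χ-reverse : ∀ r ps → χ r (reverse ps) ≡ χ r ps
    χ-reverse r ps = cong (λ b → if b then 1ℚ else 0ℚ) (∈ᵇ-reverse r ps)

    valid : List (Fin n) → Bool
    valid p = distinct p ∧ chain p

    module _ (H : List (Fin n) → ℚ) where

      ∑-extensions : ℕ → List (Fin n) → ℚ
      ∑-extensions m pre = ∑[ q ← seqs m ] (if valid (pre ++ q) then H (pre ++ q) else 0ℚ)

      ∑-extensions-nonNeg : (∀ p → 0ℚ ≤ H p) → ∀ m pre → 0ℚ ≤ ∑-extensions m pre
      ∑-extensions-nonNeg H-nonNeg m pre = ∑-nonNeg (seqs m) (λ q → if-valid-nonNeg (pre ++ q))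
        where
        if-valid-nonNeg : ∀ p → 0ℚ ≤ (if valid p then H p else 0ℚ)
        if-valid-nonNeg p with valid p
        ... | true = H-nonNeg p
        ... | false = ≤-refl

      ∑-extensions-zero : ∀ pre → valid pre ≡ true → ∑-extensions 0 pre ≡ H pre
      ∑-extensions-zero pre pre-valid rewrite List.++-identityʳ pre | pre-valid = +-identityʳ (H pre)

      ∑-extensions-suc : ∀ m pre → ∑-extensions (suc m) pre ≡ ∑[ v ← allFin n ] ∑-extensions m (pre ∷ʳ v)
      ∑-extensions-suc m pre =
        trans (∑-concatMap (allFin n) (λ v → map (v ∷_) (seqs m)) _)
          (∑-cong (allFin n) λ v → trans (∑-map (seqs m) (v ∷_) _)
            (∑-cong (seqs m) λ q → cong (λ p → if valid p then H p else 0ℚ) (sym (List.∷ʳ-++ pre v q))))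

      ∑-extensions-≤-∑-simplePaths : (∀ p → 0ℚ ≤ H p) → ∀ s l → ∑-extensions l (s ∷ []) ≤ ∑ (simplePaths s l) H
      ∑-extensions-≤-∑-simplePaths H-nonNeg s l = begin
        ∑-extensions l (s ∷ [])              ≡⟨ ∑-cong (seqs l) (λ q → cong (λ b → if b then H (s ∷ q) else 0ℚ) (starting q)) ⟨
        ∑[ q ← seqs l ] simple (s ∷ q)       ≡⟨ ∑-map (seqs l) (s ∷_) simple ⟨
        ∑ (map (s ∷_) (seqs l)) simple       ≤⟨ ∈⇒≤∑ (λ v → ∑ (map (v ∷_) (seqs l)) simple)
                                                  (λ v → ∑-nonNeg (map (v ∷_) (seqs l)) simple-nonNeg) (∈-allFin s) ⟩
        ∑[ v ← allFin n ] ∑ (map (v ∷_) (seqs l)) simple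
                                             ≡⟨ ∑-concatMap (allFin n) (λ v → map (v ∷_) (seqs l)) simple ⟨
        ∑ (seqs (suc l)) simple              ≡⟨ ∑-filter (λ p → startsAt s p ∧ valid p ≟ᵇ true) (seqs (suc l)) H ⟨
        ∑ (simplePaths s l) H                ∎
        where
        open ≤-Reasoning
        simple : List (Fin n) → ℚ
        simple p = if does (startsAt s p ∧ valid p ≟ᵇ true) then H p else 0ℚ
        simple-nonNeg : ∀ p → 0ℚ ≤ simple p
        simple-nonNeg p with does (startsAt s p ∧ valid p ≟ᵇ true)
        ... | true = H-nonNeg p
        ... | false = ≤-refl
        starting : ∀ q → does (startsAt s (s ∷ q) ∧ valid (s ∷ q) ≟ᵇ true) ≡ valid (s ∷ q)
        starting q rewrite dec-true (s ≟ᶠ s) refl = does-≟-true (valid (s ∷ q))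

    module _ (D : Fin n → Bool) where

      -- The (reversed) prefixes that walk D reaches with positive probability.
      record Feasible (ps : List (Fin n)) : Set where
        field
          simple          : distinct (reverse ps) ≡ true
          chained         : chain (reverse ps) ≡ true
          weight-positive : 0ℚ < weight D ps
          𝒲≤weight        : 𝒲 ps ≤ weight D ps

      feasible-[_] : ∀ s → Feasible (s ∷ [])
      feasible-[ s ] = record
        { simple = refl ; chained = refl ; weight-positive = *<* (+<+ (ℕ.s≤s ℕ.z≤n)) ; 𝒲≤weight = ≤-refl }

      Candidate : Fin n → List (Fin n) → Fin n → Set
      Candidate c X w = (adj c w ∧ D w ∧ not (w ∈ᵇ X)) ≡ true

      candidates-D-≤ : ∀ c X → length (NminusP D c X) ℕ.≤ length (NminusP allTrue c X)
      candidates-D-≤ c X = length-filter-mono _ _ drop-D (allFin n)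
        where
        drop-D : ∀ {w} → Candidate c X w → (adj c w ∧ allTrue w ∧ not (w ∈ᵇ X)) ≡ true
        drop-D {w} cand with ∧-≡-true {adj c w} cand
        ... | cw , rest = cong₂ _∧_ cw (proj₂ (∧-≡-true {D w} rest))

      module _ (no-self-loops : ∀ v → adj v v ≡ false) where

        -- removed (c ∷ rest) omits the current vertex c itself: a candidate differs
        -- from c only because there are no self-loops.
        candidate-fresh : ∀ c rest v → Candidate c (removed (c ∷ rest)) v → v ∈ᵇ (c ∷ rest) ≡ false
        candidate-fresh c rest v cand = cong₂ _∨_ v≢c (v∉rest rest cand)
          where
          v≢c : does (v ≟ᶠ c) ≡ false
          v≢c = dec-false (v ≟ᶠ c) λ { refl → contradiction (trans (sym (proj₁ (∧-≡-true {adj v v} cand))) (no-self-loops v)) λ () }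
          v∉rest : ∀ ys → Candidate c (removed (c ∷ ys)) v → v ∈ᵇ ys ≡ false
          v∉rest [] _ = refl
          v∉rest (_ ∷ _) fresh = not-≡-true (proj₂ (∧-≡-true {D v} (proj₂ (∧-≡-true {adj c v} fresh))))

        feasible-∷ : ∀ {c rest v x xs} → NminusP D c (removed (c ∷ rest)) ≡ x ∷ xs →
          Feasible (c ∷ rest) → Candidate c (removed (c ∷ rest)) v → Feasible (v ∷ c ∷ rest)
        feasible-∷ {c} {rest} {v} {x} {xs} candidates feasible cand = record
          { simple          = subst (λ p → distinct p ≡ true) (sym (List.unfold-reverse v (c ∷ rest)))
                         (distinct-∷ʳ (reverse (c ∷ rest)) v simple
                           (trans (∈ᵇ-reverse v (c ∷ rest)) (candidate-fresh c rest v cand)))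
          ; chained         = subst (λ p → chain p ≡ true)
                                (sym (trans (List.unfold-reverse v (c ∷ rest)) (cong (_∷ʳ v) (List.unfold-reverse c rest))))
                         (chain-∷ʳ (reverse rest) c v (subst (λ p → chain p ≡ true) (List.unfold-reverse c rest) chained)
                           (proj₁ (∧-≡-true {adj c v} cand)))
          ; weight-positive = subst (0ℚ <_) (sym weight-∷)
                                (positive⁻¹ _ {{pos*pos⇒pos P {{positive weight-positive}} _ {{inv-suc-positive (length xs)}}}})
          ; 𝒲≤weight        = begin
              𝒲 (c ∷ rest) * inv L           ≤⟨ *-monoʳ-≤-nonNeg (inv L) {{nonNegative (inv-nonNeg L)}} 𝒲≤weight ⟩
              P * inv L                      ≤⟨ *-monoˡ-≤-nonNeg P {{nonNegative (<⇒≤ weight-positive)}}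
                                                  (inv-antimono-≤ (subst (λ cs → length cs ℕ.≤ L) candidates (candidates-D-≤ c X))) ⟩
              P * inv (suc (length xs))      ≡⟨ weight-∷ ⟨
              weight D (v ∷ c ∷ rest)        ∎
          }
          where
          open Feasible feasible
          open ≤-Reasoning
          X = removed (c ∷ rest)
          P = weight D (c ∷ rest)
          L = length (NminusP allTrue c X)
          weight-∷ : weight D (v ∷ c ∷ rest) ≡ P * inv (suc (length xs))
          weight-∷ = cong (λ cs → P * inv (length cs)) candidates

        module _ (g : Maybe (List (Fin n)) → ℚ) (H : List (Fin n) → ℚ)
                 (g-nothing : g nothing ≡ 0ℚ) (H-nonNeg : ∀ p → 0ℚ ≤ H p)
                 (g-just-≤ : ∀ ps → Feasible ps → weight D ps * g (just ps) ≤ H (reverse ps)) where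

          -- The left side is Σ ℙ(p) g(p) over the walk's completions p of the prefix
          -- (g vanishes on failed walks), and every completion is a simple extension of it.
          weight-*-𝔼-walk-≤ : ∀ m c rest → Feasible (c ∷ rest) →
            weight D (c ∷ rest) * 𝔼[ g ∣ walk D m (c ∷ rest) ] ≤ ∑-extensions H m (reverse (c ∷ rest))
          weight-*-𝔼-walk-≤ zero c rest feasible = begin
            P * (1ℚ * g (just (c ∷ rest)) + 0ℚ) ≡⟨ cong (P *_) (trans (+-identityʳ _) (*-identityˡ _)) ⟩
            P * g (just (c ∷ rest))           ≤⟨ g-just-≤ (c ∷ rest) feasible ⟩
            H (reverse (c ∷ rest))            ≡⟨ ∑-extensions-zero H (reverse (c ∷ rest)) (cong₂ _∧_ simple chained) ⟨
            ∑-extensions H 0 (reverse (c ∷ rest)) ∎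
            where
            open ≤-Reasoning
            open Feasible feasible
            P = weight D (c ∷ rest)
          weight-*-𝔼-walk-≤ (suc m) c rest feasible with NminusP D c (removed (c ∷ rest)) in candidates
          ... | [] = begin
            P * (1ℚ * g nothing + 0ℚ)  ≡⟨ cong (λ z → P * (1ℚ * z + 0ℚ)) g-nothing ⟩
            P * 0ℚ                     ≡⟨ *-zeroʳ P ⟩
            0ℚ                         ≤⟨ ∑-extensions-nonNeg H H-nonNeg (suc m) (reverse (c ∷ rest)) ⟩
            ∑-extensions H (suc m) (reverse (c ∷ rest)) ∎
            where
            open ≤-Reasoning
            P = weight D (c ∷ rest)
          ... | x ∷ xs = begin
            P * 𝔼[ g ∣ uniform (x ∷ xs) >>= next ]  ≡⟨ cong (P *_) (trans (𝔼[∣>>=] g (uniform (x ∷ xs)) next) (𝔼[∣uniform] E (x ∷ xs))) ⟩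
            P * ∑[ v ← x ∷ xs ] (inv L * E v)       ≡⟨ *-distribˡ-∑ P (x ∷ xs) _ ⟩
            ∑[ v ← x ∷ xs ] (P * (inv L * E v))     ≡⟨ cong (λ cs → ∑[ v ← cs ] (P * (inv L * E v))) candidates ⟨
            ∑[ v ← NminusP D c (removed (c ∷ rest)) ] (P * (inv L * E v))
              ≤⟨ ∑-filter-≤ _ (allFin n) step (λ v → ∑-extensions-nonNeg H H-nonNeg m (reverse (c ∷ rest) ∷ʳ v)) ⟩
            ∑[ v ← allFin n ] ∑-extensions H m (reverse (c ∷ rest) ∷ʳ v) ≡⟨ ∑-extensions-suc H m (reverse (c ∷ rest)) ⟨
            ∑-extensions H (suc m) (reverse (c ∷ rest)) ∎
            where
            open ≤-Reasoning
            P = weight D (c ∷ rest)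
            L = length (x ∷ xs)
            next : Fin n → Dist (Maybe (List (Fin n)))
            next v = walk D m (v ∷ c ∷ rest)
            E : Fin n → ℚ
            E v = 𝔼[ g ∣ next v ]
            step : ∀ v → Candidate c (removed (c ∷ rest)) v →
              P * (inv L * E v) ≤ ∑-extensions H m (reverse (c ∷ rest) ∷ʳ v)
            step v cand = begin
              P * (inv L * E v)               ≡⟨ *-assoc P (inv L) (E v) ⟨
              (P * inv L) * E v               ≡⟨ cong (λ cs → (P * inv (length cs)) * E v) candidates ⟨
              weight D (v ∷ c ∷ rest) * E v   ≤⟨ weight-*-𝔼-walk-≤ m v (c ∷ rest) (feasible-∷ candidates feasible cand) ⟩
              ∑-extensions H m (reverse (v ∷ c ∷ rest)) ≡⟨ cong (∑-extensions H m) (List.unfold-reverse v (c ∷ rest)) ⟩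
              ∑-extensions H m (reverse (c ∷ rest) ∷ʳ v) ∎

          𝔼-walk-≤-∑-simplePaths : ∀ s l → 𝔼[ g ∣ walk D l (s ∷ []) ] ≤ ∑ (simplePaths s l) H
          𝔼-walk-≤-∑-simplePaths s l = begin
            𝔼[ g ∣ walk D l (s ∷ []) ]        ≡⟨ *-identityˡ _ ⟨
            1ℚ * 𝔼[ g ∣ walk D l (s ∷ []) ]   ≤⟨ weight-*-𝔼-walk-≤ l s [] feasible-[ s ] ⟩
            ∑-extensions H l (s ∷ [])          ≤⟨ ∑-extensions-≤-∑-simplePaths H H-nonNeg s l ⟩
            ∑ (simplePaths s l) H              ∎
            where open ≤-Reasoning

module SecondMoment where

  open import Data.Nat as ℕ using (ℕ; suc)
  open import Data.Fin using (Fin)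
  open import Data.Fin.Properties using () renaming (_≟_ to _≟ᶠ_)
  open import Data.Bool using (Bool; true; false; if_then_else_)
  open import Data.Bool.Properties using () renaming (_≟_ to _≟ᵇ_)
  open import Data.List using (List; []; _∷_; map; filter; length; reverse; allFin; upTo)
  import Data.List.Properties as List
  open import Data.Maybe using (Maybe; just)
  open import Data.Rational using (ℚ; 0ℚ; 1ℚ; _+_; _-_; -_; _*_; _≤_; Positive; positive; nonNegative)
  open import Data.Rational.Properties
  open import Data.Rational.Solver using (module +-*-Solver)
  open import Relation.Binary.PropositionalEquality
  open import Relation.Nullary using (does; yes; no; contradiction)
  open import Defs
  open Arithmetic
  open Expectation
  open Walks

  square : ℚ → ℚ
  square x = x * x

  Var-≤-𝔼-square : ∀ d → Var d ≤ 𝔼 (mapD square d)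
  Var-≤-𝔼-square d = begin
    𝔼 (mapD square d) - 𝔼 d * 𝔼 d  ≤⟨ +-monoʳ-≤ (𝔼 (mapD square d)) (neg-antimono-≤ (square-nonNeg (𝔼 d))) ⟩
    𝔼 (mapD square d) + - 0ℚ      ≡⟨ +-identityʳ (𝔼 (mapD square d)) ⟩
    𝔼 (mapD square d)             ∎
    where open ≤-Reasoning

  module _ {n : ℕ} (adj : Fin n → Fin n → Bool) (no-self-loops : ∀ v → adj v v ≡ false)
           (RF D : Fin n → Bool) (r : Fin n) {{n⁺ : Positive (ℕtoℚ n)}} where
    open Graph adj

    α : ℚ
    α = ℕtoℚ (card RF) ÷₀ ℕtoℚ n

    centralityTerm : List (Fin n) → ℚ
    centralityTerm p = χ r p * 𝒲 (reverse p)

    centralityTerm-nonNeg : ∀ p → 0ℚ ≤ centralityTerm p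
    centralityTerm-nonNeg p = *-nonNeg (χ-nonNeg adj r p) (weight-nonNeg adj allTrue (reverse p))

    estimate² : Maybe (List (Fin n)) → ℚ
    estimate² o = square (estimate RF D r o)

    weight-*-estimate²-≤ : ∀ ps → Feasible adj D ps →
      weight D ps * estimate² (just ps) ≤ (α * α) * centralityTerm (reverse ps)
    weight-*-estimate²-≤ ps feasible
      rewrite χ-reverse adj r ps | List.reverse-involutive ps with r ∈ᵇ ps
    ... | true = begin
      P * square ((C * W) ÷₀ (ℕtoℚ n * P))     ≡⟨ cong (λ e → P * square e) (÷₀-*-interchange C W (ℕtoℚ n) P) ⟩
      P * square (α * (W ÷₀ P))                 ≤⟨ *-square-÷₀-≤ α W P (weight-nonNeg adj allTrue ps) 𝒲≤weight ⟩
      (α * α) * W                               ≡⟨ cong ((α * α) *_) (*-identityˡ W) ⟨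
      (α * α) * (1ℚ * W)                        ∎
      where
      open ≤-Reasoning
      open Feasible feasible
      P = weight D ps
      W = 𝒲 ps
      C = ℕtoℚ (card RF)
      instance P⁺ : Positive P
      P⁺ = positive weight-positive
    ... | false = begin
      weight D ps * (0ℚ * 0ℚ)    ≡⟨ *-zeroʳ (weight D ps) ⟩
      0ℚ                          ≤⟨ *-nonNeg (square-nonNeg α) (*-nonNeg ≤-refl (weight-nonNeg adj allTrue ps)) ⟩
      (α * α) * (0ℚ * 𝒲 ps)      ∎
      where open ≤-Reasoning

    𝔼-walk-estimate²-≤ : ∀ s l →
      𝔼[ estimate² ∣ walk D l (s ∷ []) ] ≤ (α * α) * ∑ (simplePaths s l) centralityTerm
    𝔼-walk-estimate²-≤ s l = begin
      𝔼[ estimate² ∣ walk D l (s ∷ []) ]                 ≤⟨ 𝔼-walk-≤-∑-simplePaths adj D no-self-loops estimate² H refl H-nonNeg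
                                                              weight-*-estimate²-≤ s l ⟩
      ∑[ p ← simplePaths s l ] H p                       ≡⟨ *-distribˡ-∑ (α * α) (simplePaths s l) centralityTerm ⟨
      (α * α) * ∑ (simplePaths s l) centralityTerm       ∎
      where
      open ≤-Reasoning
      H : List (Fin n) → ℚ
      H p = (α * α) * centralityTerm p
      H-nonNeg : ∀ p → 0ℚ ≤ H p
      H-nonNeg p = *-nonNeg (square-nonNeg α) (centralityTerm-nonNeg p)

    lengths : ℕ → List ℕ
    lengths k = map suc (upTo k)

    startsInRF : List (Fin n)
    startsInRF = filter (λ s → RF s ≟ᵇ true) (allFin n)

    centralityFrom : ℕ → Fin n → ℚ
    centralityFrom k s = ∑[ l ← lengths k ] ∑ (simplePaths s l) centralityTerm

    𝔼-square-APAD : ∀ k → 𝔼 (mapD square (APAD-c k RF D r))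
      ≡ ∑[ s ← startsInRF ] (inv (card RF) * ∑[ l ← lengths k ] (inv (length (lengths k)) * 𝔼[ estimate² ∣ walk D l (s ∷ []) ]))
    𝔼-square-APAD k = begin
      𝔼 (mapD square d)                      ≡⟨ 𝔼-𝔼[id] (mapD square d) ⟩
      𝔼[ (λ x → x) ∣ mapD square d ]         ≡⟨ 𝔼[∣mapD] square (λ x → x) d ⟩
      𝔼[ square ∣ d ]                        ≡⟨ 𝔼[∣>>=] square (uniform startsInRF) _ ⟩
      𝔼[ (λ s → 𝔼[ square ∣ fromStart s ]) ∣ uniform startsInRF ] ≡⟨ 𝔼[∣uniform] _ startsInRF ⟩
      ∑[ s ← startsInRF ] (inv (card RF) * 𝔼[ square ∣ fromStart s ])
        ≡⟨ ∑-cong startsInRF (λ s → cong (inv (card RF) *_) (trans (𝔼[∣>>=] square (uniform (lengths k)) _)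
             (trans (𝔼[∣uniform] _ (lengths k)) (∑-cong (lengths k) λ l →
               cong (inv (length (lengths k)) *_) (𝔼[∣mapD] (estimate RF D r) square (walk D l (s ∷ []))))))) ⟩
      ∑[ s ← startsInRF ] (inv (card RF) * ∑[ l ← lengths k ] (inv (length (lengths k)) * 𝔼[ estimate² ∣ walk D l (s ∷ []) ])) ∎
      where
      open ≡-Reasoning
      d = APAD-c k RF D r
      fromStart : Fin n → Dist ℚ
      fromStart s = uniform (lengths k) >>= λ l → mapD (estimate RF D r) (walk D l (s ∷ []))

    centralityFrom-nonNeg : ∀ k s → 0ℚ ≤ centralityFrom k s
    centralityFrom-nonNeg k s = ∑-nonNeg (lengths k) (λ l → ∑-nonNeg (simplePaths s l) centralityTerm-nonNeg)

    𝔼-square-APAD-≤ : ∀ k → (∀ s → RF s ≡ true → s ≢ r) →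
      𝔼 (mapD square (APAD-c k RF D r))
        ≤ (inv (card RF) * (inv (length (lengths k)) * (α * α)))
            * ∑[ s ← allFin n ] (if does (s ≟ᶠ r) then 0ℚ else centralityFrom k s)
    𝔼-square-APAD-≤ k RF⇒≢r = begin
      𝔼 (mapD square (APAD-c k RF D r))
        ≡⟨ 𝔼-square-APAD k ⟩
      ∑[ s ← startsInRF ] (iC * ∑[ l ← lengths k ] (ik * 𝔼[ estimate² ∣ walk D l (s ∷ []) ]))
        ≤⟨ ∑-mono-≤ startsInRF (λ s → *-monoˡ-≤-nonNeg iC {{nonNegative (inv-nonNeg (card RF))}}
             (∑-mono-≤ (lengths k) (λ l → *-monoˡ-≤-nonNeg ik {{nonNegative (inv-nonNeg (length (lengths k)))}}
               (𝔼-walk-estimate²-≤ s l)))) ⟩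
      ∑[ s ← startsInRF ] (iC * ∑[ l ← lengths k ] (ik * ((α * α) * ∑ (simplePaths s l) centralityTerm)))
        ≡⟨ ∑-cong startsInRF pull-constants ⟩
      ∑[ s ← startsInRF ] (K * centralityFrom k s)
        ≡⟨ *-distribˡ-∑ K startsInRF (centralityFrom k) ⟨
      K * ∑ startsInRF (centralityFrom k)
        ≤⟨ *-monoˡ-≤-nonNeg K {{nonNegative K-nonNeg}} (∑-filter-≤ _ (allFin n) drop-r excluding-r-nonNeg) ⟩
      K * ∑[ s ← allFin n ] excluding-r s ∎
      where
      open ≤-Reasoning
      iC = inv (card RF)
      ik = inv (length (lengths k))
      K = iC * (ik * (α * α))
      K-nonNeg : 0ℚ ≤ K
      K-nonNeg = *-nonNeg (inv-nonNeg (card RF)) (*-nonNeg (inv-nonNeg (length (lengths k))) (square-nonNeg α))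
      pull-constants : ∀ s → iC * ∑[ l ← lengths k ] (ik * ((α * α) * ∑ (simplePaths s l) centralityTerm))
                             ≡ K * centralityFrom k s
      pull-constants s = begin-equality
        iC * ∑[ l ← lengths k ] (ik * ((α * α) * Y l))   ≡⟨ cong (iC *_) (∑-cong (lengths k) (λ l → *-assoc ik (α * α) (Y l))) ⟨
        iC * ∑[ l ← lengths k ] ((ik * (α * α)) * Y l)   ≡⟨ cong (iC *_) (*-distribˡ-∑ (ik * (α * α)) (lengths k) Y) ⟨
        iC * ((ik * (α * α)) * centralityFrom k s)       ≡⟨ *-assoc iC (ik * (α * α)) (centralityFrom k s) ⟨
        K * centralityFrom k s                           ∎
        where
        Y : ℕ → ℚ
        Y l = ∑ (simplePaths s l) centralityTerm
      excluding-r : Fin n → ℚ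
      excluding-r s = if does (s ≟ᶠ r) then 0ℚ else centralityFrom k s
      excluding-r-nonNeg : ∀ s → 0ℚ ≤ excluding-r s
      excluding-r-nonNeg s with does (s ≟ᶠ r)
      ... | true = ≤-refl
      ... | false = centralityFrom-nonNeg k s
      drop-r : ∀ s → RF s ≡ true → centralityFrom k s ≤ excluding-r s
      drop-r s s∈RF with s ≟ᶠ r
      ... | yes s≡r = contradiction s≡r (RF⇒≢r s s∈RF)
      ... | no _ = ≤-refl

    Var-APAD-≤ : ∀ k → (∀ s → RF s ≡ true → s ≢ r) → Var (APAD-c k RF D r) ≤ α * pc k r
    Var-APAD-≤ k RF⇒≢r = begin
      Var (APAD-c k RF D r)                ≤⟨ Var-≤-𝔼-square (APAD-c k RF D r) ⟩
      𝔼 (mapD square (APAD-c k RF D r))    ≤⟨ 𝔼-square-APAD-≤ k RF⇒≢r ⟩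
      (inv (card RF) * (inv (length (lengths k)) * (α * α))) * S
        ≡⟨ cong (λ m → (inv (card RF) * (inv m * (α * α))) * S) (trans (List.length-map suc (upTo k)) (List.length-upTo k)) ⟩
      (inv (card RF) * (inv k * (α * α))) * S
        ≡⟨ cong (_* S) (solve 3 (λ c k a → c :* (k :* a) := k :* (c :* a)) refl (inv (card RF)) (inv k) (α * α)) ⟩
      (inv k * (inv (card RF) * (α * α))) * S  ≡⟨ cong (λ x → (inv k * x) * S) (inv-*-÷₀-square (card RF) (ℕtoℚ n)) ⟩
      (inv k * (α * inv n)) * S
        ≡⟨ cong (_* S) (solve 3 (λ k a m → k :* (a :* m) := a :* (k :* m)) refl (inv k) α (inv n)) ⟩
      (α * (inv k * inv n)) * S               ≡⟨ cong (λ x → (α * x) * S) (inv-* k n) ⟨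
      (α * inv (k ℕ.* n)) * S                 ≡⟨ *-assoc α (inv (k ℕ.* n)) S ⟩
      α * pc k r                              ∎
      where
      open ≤-Reasoning
      open +-*-Solver
      S = ∑[ s ← allFin n ] (if does (s ≟ᶠ r) then 0ℚ else centralityFrom k s)

open import Defs
open import Data.Bool using (Bool; true; false)
open import Data.Nat using (ℕ; _≤_)
open import Data.Fin using (Fin)
open import Data.Product using (_×_; ∃)
open import Data.Sum using (_⊎_)
open import Data.Rational using (ℚ; _*_) renaming (_≤_ to _≤ℚ_)
open import Relation.Binary.PropositionalEquality using (_≡_; _≢_)
open import Function.Bundles using (_⇔_)

open import Data.Nat using (zero; suc)
open import Data.Product using (proj₁)
open import Function.Bundles using (Equivalence)
open Arithmetic using (ℕtoℚ-suc-positive)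
open SecondMoment using (Var-APAD-≤)

lemma5p3 : {n : ℕ} (adj : Fin n → Fin n → Bool) → let open Graph adj in
  (∀ v → adj v v ≡ false) →
  WeaklyConnected →
  (k : ℕ) → 1 ≤ k →
  (r : Fin n) → (∃ λ u → Edge u r) → (∃ λ v → Edge r v) →
  (RF D : Fin n → Bool) →
  (∀ s → (RF s ≡ true) ⇔ (s ≢ r × Reach s r)) →
  (∀ v → (D v ≡ true) ⇔ ((v ≢ r × Reach v r) ⊎ (v ≡ r ⊎ (v ≢ r × Reach r v)))) →
  Var (APAD-c k RF D r) ≤ℚ ((ℕtoℚ (card RF) ÷₀ ℕtoℚ n) * pc k r)
lemma5p3 {zero} _ _ _ _ _ () _ _ _ _ _ _
lemma5p3 {suc n} adj no-self-loops _ k _ r _ _ RF D RF-spec _ =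
  Var-APAD-≤ adj no-self-loops RF D r {{ℕtoℚ-suc-positive n}} k
    (λ s s∈RF → proj₁ (Equivalence.to (RF-spec s) s∈RF))
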